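{- Suppose that a fractal $\mathsf{PHHF}(4;\kappa,(w_1,w_2,w_3,w_4),4)$ exists and $n\ge 7$. Then: (i) for every integer $k\ge 1$, a $\mathsf{PHHF}(n;7\kappa+(n-7)k,(3\kappa+(n-7)k+w_1+w_2+w_3+w_4)^7(7\kappa+(n-8)k+1)^{n-7},2n-5)$ exists; (ii) if $w_1+w_2+w_3+w_4\le 4\kappa$, a $\mathsf{PHF}(n;(4n-21)\kappa-(n-7)(w_1+w_2+w_3+w_4-1),(4n-25)\kappa-(n-8)(w_1+w_2+w_3+w_4-1)+1,2n-5)$ exists.
   Context: An $\mathsf{HHF}(N;k,(w_1,\dots,w_N))$ is an $N\times k$ array in which row $i$ contains at most $w_i$ distinct symbols. Given a set $S$ of columns and a partition of $S$ into $p$ classes (some possibly empty), a row $r$ separates it if any two columns in distinct classes have distinct entries in row $r$. A $\mathsf{DHHF}(N;k,(w_1,\dots,w_N),t,p)$ is an $\mathsf{HHF}(N;k,(w_1,\dots,w_N))$ in which every partition of every $t$-set of columns into $p$ classes is separated by some row. A $\mathsf{PHHF}(N;k,(w_1,\dots,w_N),t)$ is a $\mathsf{DHHF}(N;k,(w_1,\dots,w_N),t,t)$; when all $w_i=w$ it is written $\mathsf{PHF}(N;k,w,t)$. A $\mathsf{DHHF}(t;k,(v_1,\dots,v_t),t,p)$ is fractal if $t\le 2$, or if for each row $j$, deleting row $j$ yields a fractal $\mathsf{DHHF}(t-1;k,(v_1,\dots,v_{j-1},v_{j+1},\dots,v_t),t-1,\min(p,t-1))$; a fractal $\mathsf{PHHF}$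 is a fractal $\mathsf{DHHF}$ with $p=t$. Exponential notation $x_1^{u_1}\cdots x_c^{u_c}$ for the symbol-count vector means the $\sum u_i$ rows can be partitioned into classes, the $i$th class consisting of $u_i$ rows each containing at most $x_i$ symbols. -}

module Defs where

import Data.Nat as N
open import Data.Nat using (ℕ; _+_; _*_; _∸_; _≤_; _<_; _⊓_)
open import Data.Nat.Properties using (_<?_)
open import Data.Integer as ℤ using (ℤ; +_; ∣_∣)
open import Data.Fin using (Fin; toℕ; punchIn; zero; suc)
open import Data.Product using (Σ; ∃; _×_; _,_)
open import Data.Sum using (_⊎_)
open import Function.Definitions using (Injective)
open import Relation.Binary.PropositionalEquality using (_≡_; _≢_)
open import Relation.Nullary using (does)
open import Data.Bool using (if_then_else_)

Array : ℕ → ℕ → Set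
Array N k = Fin N → Fin k → ℕ

-- Row i contains at most w distinct symbols: the set of symbols occurring
-- in the row injects into a w-element set.
AtMostDistinct : {k : ℕ} → (Fin k → ℕ) → ℕ → Set
AtMostDistinct {k} row w =
  Σ (ℕ → Fin w) λ f → ∀ (c c' : Fin k) → f (row c) ≡ f (row c') → row c ≡ row c'

IsHHF : (N k : ℕ) → (Fin N → ℕ) → Array N k → Set
IsHHF N k w A = ∀ (i : Fin N) → AtMostDistinct (A i) (w i)

-- Row r separates the partition of the column set S (given as an injective
-- listing s : Fin t → Fin k) into p classes (given by π : Fin t → Fin p).
Separates : {N k t p : ℕ} → Array N k → Fin N → (Fin t → Fin k) → (Fin t → Fin p) → Set
Separates A r s π = ∀ a b → π a ≢ π b → A r (s a) ≢ A r (s b)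

IsDHHF : (N k : ℕ) → (Fin N → ℕ) → (t p : ℕ) → Array N k → Set
IsDHHF N k w t p A =
  IsHHF N k w A ×
  (∀ (s : Fin t → Fin k) → Injective _≡_ _≡_ s →
   ∀ (π : Fin t → Fin p) → ∃ λ (r : Fin N) → Separates A r s π)

IsPHHF : (N k : ℕ) → (Fin N → ℕ) → (t : ℕ) → Array N k → Set
IsPHHF N k w t A = IsDHHF N k w t t A

IsPHF : (N k w t : ℕ) → Array N k → Set
IsPHF N k w t A = IsPHHF N k (λ _ → w) t A

deleteRow : {N k : ℕ} → Fin (N.suc N) → Array (N.suc N) k → Array N k
deleteRow j A i = A (punchIn j i)

deleteEntry : {N : ℕ} → Fin (N.suc N) → (Fin (N.suc N) → ℕ) → (Fin N → ℕ)
deleteEntry j v i = v (punchIn j i)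

IsFractalDHHF : (t k : ℕ) → (Fin t → ℕ) → (p : ℕ) → Array t k → Set
IsFractalDHHF N.zero k v p A = IsDHHF 0 k v 0 p A
IsFractalDHHF (N.suc N.zero) k v p A = IsDHHF 1 k v 1 p A
IsFractalDHHF (N.suc (N.suc N.zero)) k v p A = IsDHHF 2 k v 2 p A
IsFractalDHHF (N.suc (N.suc (N.suc t))) k v p A =
  IsDHHF (3 + t) k v (3 + t) p A ×
  (∀ (j : Fin (3 + t)) →
     IsFractalDHHF (N.suc (N.suc t)) k (deleteEntry j v) (p ⊓ (2 + t)) (deleteRow j A))

IsFractalPHHF : (t k : ℕ) → (Fin t → ℕ) → Array t k → Set
IsFractalPHHF t k v A = IsFractalDHHF t k v t A

-- Exponential notation x^7 y^(n-7): the first 7 rows have at most x symbols,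
-- the remaining rows at most y (the row order is immaterial for existence).
exp7 : {n : ℕ} → ℕ → ℕ → Fin n → ℕ
exp7 x y i = if does (toℕ i <? 7) then x else y

vec4 : ℕ → ℕ → ℕ → ℕ → Fin 4 → ℕ
vec4 a b c d zero = a
vec4 a b c d (suc zero) = b
vec4 a b c d (suc (suc zero)) = c
vec4 a b c d (suc (suc (suc zero))) = d

-- Parameters, computed over ℤ (so that n - 8 = -1 when n = 7 and W - 1 is
-- not truncated) and then converted to ℕ (they are nonnegative).
ℤn : ℕ → ℤ
ℤn = +_

colsII : (n κ W : ℕ) → ℕ
colsII n κ W = ∣ (ℤ.+ (4 * n) ℤ.- ℤn 21) ℤ.* ℤn κ ℤ.- (ℤn n ℤ.- ℤn 7) ℤ.* (ℤn W ℤ.- ℤn 1) ∣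

symsII : (n κ W : ℕ) → ℕ
symsII n κ W = ∣ (ℤn (4 * n) ℤ.- ℤn 25) ℤ.* ℤn κ ℤ.- (ℤn n ℤ.- ℤn 8) ℤ.* (ℤn W ℤ.- ℤn 1) ℤ.+ ℤn 1 ∣

symsI₂ : (n κ k : ℕ) → ℕ
symsI₂ n κ k = ∣ ℤn (7 * κ) ℤ.+ (ℤn n ℤ.- ℤn 8) ℤ.* ℤn k ℤ.+ ℤn 1 ∣

-- Lay out seven copies ("groups") of the columns of the fractal PHHF B, followed by
-- n − 7 blocks of k new columns.  The first seven rows follow a cyclic design over ℤ/7:
-- in row ρ the groups at offsets 0, 1, 3 from ρ (a planar difference set) get injective
-- symbols from three shared alphabets of size κ, the groups at offsets 2, 4, 5, 6 get
-- rows 1–4 of B written on disjoint alphabets, and every new column gets its own symbol.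
-- Each further row j is injective except that it collapses block j to one symbol.
--
-- Only the partition into singletons matters: a row injective on a set separates every
-- partition of it.  Suppose no row is injective on a set of 2n − 5 = 9 + 2(n − 7)
-- columns.  Then every block holds two of them, and every one of the first seven rows
-- has a B-row colliding inside one of its B-groups.  A group meeting the set in u
-- columns has at most u − 1 colliding B-rows (the fractal property), and a finite check
-- over the seven rows forces the groups to hold at least 10 columns: too many.
-- Part (ii) is part (i) with k = 4κ − (w₁ + w₂ + w₃ + w₄) + 1, where all symbol counts agree.
module Submission where

open import Defs
open import Data.Nat using (ℕ; _+_; _*_; _∸_; _≤_)
open import Data.Product using (∃; _×_)

open import Data.Bool using (Bool; true; _∧_; T; if_then_else_)
open import Data.Fin as Fin
  using (Fin; zero; suc; toℕ; punchIn; punchOut; inject≤; _↑ˡ_; _↑ʳ_; splitAt; join)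
open import Data.Fin.Properties as Fin using (_≟_; all?; any?; 1↔⊤; +↔⊎; *↔×)
open import Data.Integer as ℤ using (+_; ∣_∣)
import Data.Integer.Properties as ℤ
import Data.Integer.Tactic.RingSolver as ℤ-Solver
open import Data.Nat using (zero; suc; _<_; _≤ᵇ_; z≤n; s≤s)
open import Data.Nat.DivMod using (_mod_; m<n⇒m%n≡m)
import Data.Nat.Properties as ℕ
import Data.Nat.Tactic.RingSolver as ℕ-Solver
open import Algebra.Properties.CommutativeMonoid.Sum ℕ.+-0-commutativeMonoid
  using (sum; sum-syntax; ∑-comm; sum-cong-≗; sum-replicate-zero)
open import Data.Product using (Σ; ∃₂; _,_; proj₁; proj₂)
open import Data.Product.Properties using (,-injectiveʳ; Σ-≡,≡←≡)
open import Data.Sum as Sum using (_⊎_; inj₁; inj₂)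
open import Data.Sum.Function.Propositional using (_⊎-↣_; _⊎-↔_)
open import Data.Sum.Properties as Sum using (inj₁-injective; inj₂-injective)
open import Data.Unit using (⊤; tt)
open import Data.Vec using (Vec; []; _∷_; lookup; tabulate)
open import Data.Vec.Properties using (lookup∘tabulate)
open import Function using (_∘_; _↣_; _↔_; Injection; Inverse; mk↣)
open import Function.Construct.Composition using (_↣-∘_; _↔-∘_)
open import Function.Definitions using (Injective)
open import Function.Properties.Inverse using (↔⇒↣; ↔-sym)
open import Level using (Level)
open import Relation.Binary.Definitions using (tri<; tri≈; tri>)
open import Relation.Binary.PropositionalEquality
open import Relation.Nullary using (Dec; yes; no; does; ¬_; ¬?; map′; contradiction)
open import Relation.Nullary.Decidable
  using (dec-true; toWitness; decidable-stable; _→-dec_; _×-dec_)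
open import Relation.Unary using (Pred; Decidable)

private
  variable
    ℓ : Level
    c k m n t u : ℕ

count : {P : Pred (Fin n) ℓ} → Decidable P → ℕ
count {n = n} P? = ∑[ a < n ] (if does (P? a) then 1 else 0)

select : {P : Pred (Fin n) ℓ} (P? : Decidable P) → Fin (count P?) → Fin n
select {n = suc n} P? i with P? zero
select {n = suc n} P? zero    | yes _ = zero
select {n = suc n} P? (suc i) | yes _ = suc (select (P? ∘ suc) i)
select {n = suc n} P? i       | no _  = suc (select (P? ∘ suc) i)

select-∈ : {P : Pred (Fin n) ℓ} (P? : Decidable P) (i : Fin (count P?)) → P (select P? i)
select-∈ {n = suc n} P? i with P? zero
select-∈ {n = suc n} P? zero    | yes p = p
select-∈ {n = suc n} P? (suc i) | yes _ = select-∈ (P? ∘ suc) i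
select-∈ {n = suc n} P? i       | no _  = select-∈ (P? ∘ suc) i

select-injective : {P : Pred (Fin n) ℓ} (P? : Decidable P) → Injective _≡_ _≡_ (select P?)
select-injective {n = suc n} P? {i} {j} eq with P? zero
select-injective {n = suc n} P? {zero}  {zero}  eq | yes _ = refl
select-injective {n = suc n} P? {suc i} {suc j} eq | yes _ =
  cong suc (select-injective (P? ∘ suc) (Fin.suc-injective eq))
select-injective {n = suc n} P? {i}     {j}     eq | no _  =
  select-injective (P? ∘ suc) (Fin.suc-injective eq)

select-surjective : {P : Pred (Fin n) ℓ} (P? : Decidable P) → ∀ {a} → P a → ∃ λ i → select P? i ≡ a
select-surjective {n = suc n} P? {a} pa with P? zero
select-surjective {n = suc n} P? {zero}  pa | yes _ = zero , refl
select-surjective {n = suc n} P? {suc a} pa | yes _ with select-surjective (P? ∘ suc) pa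
... | i , eq = suc i , cong suc eq
select-surjective {n = suc n} P? {zero}  pa | no ¬p = contradiction pa ¬p
select-surjective {n = suc n} P? {suc a} pa | no _ with select-surjective (P? ∘ suc) pa
... | i , eq = i , cong suc eq

count-≤ : {P : Pred (Fin n) ℓ} (P? : Decidable P) → count P? ≤ n
count-≤ P? = Fin.injective⇒≤ (select-injective P?)

two≤count : {P : Pred (Fin n) ℓ} (P? : Decidable P) → ∀ {a b} → a ≢ b → P a → P b → 2 ≤ count P?
two≤count P? {a} {b} a≢b pa pb with select-surjective P? pa | select-surjective P? pb
... | i , refl | j , refl = Fin.injective⇒≤ pair-injective
  where
  pair : Fin 2 → Fin (count P?)
  pair zero       = i
  pair (suc zero) = j

  pair-injective : Injective _≡_ _≡_ pair
  pair-injective {zero}     {zero}     _   = refl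
  pair-injective {zero}     {suc zero} i≡j = contradiction (cong (select P?) i≡j) a≢b
  pair-injective {suc zero} {zero}     j≡i = contradiction (cong (select P?) (sym j≡i)) a≢b
  pair-injective {suc zero} {suc zero} _   = refl

count-mono : {P Q : Pred (Fin n) ℓ} (P? : Decidable P) (Q? : Decidable Q) →
             (∀ {a} → P a → Q a) → count P? ≤ count Q?
count-mono {n = zero}  P? Q? P⊆Q = z≤n
count-mono {n = suc n} P? Q? P⊆Q with P? zero | Q? zero
... | yes p | yes _ = s≤s (count-mono (P? ∘ suc) (Q? ∘ suc) P⊆Q)
... | yes p | no ¬q = contradiction (P⊆Q p) ¬q
... | no _  | yes _ = ℕ.m≤n⇒m≤1+n (count-mono (P? ∘ suc) (Q? ∘ suc) P⊆Q)
... | no _  | no _  = count-mono (P? ∘ suc) (Q? ∘ suc) P⊆Q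

count-≡0 : {P : Pred (Fin n) ℓ} (P? : Decidable P) → (∀ a → ¬ P a) → count P? ≡ 0
count-≡0 {n = zero}  P? ¬P = refl
count-≡0 {n = suc n} P? ¬P with P? zero
... | yes p = contradiction p (¬P zero)
... | no _  = count-≡0 (P? ∘ suc) (¬P ∘ suc)

count-punchIn : {P : Pred (Fin (suc n)) ℓ} (P? : Decidable P) (j : Fin (suc n)) →
                ¬ P j → count P? ≡ count (P? ∘ punchIn j)
count-punchIn P? zero ¬pj with P? zero
... | yes pj = contradiction pj ¬pj
... | no _   = refl
count-punchIn {n = suc n} P? (suc j) ¬pj =
  cong (_+_ (if does (P? zero) then 1 else 0)) (count-punchIn (P? ∘ suc) j ¬pj)

count-≤-∸1 : {P : Pred (Fin n) ℓ} (P? : Decidable P) (j : Fin n) → ¬ P j → count P? ≤ n ∸ 1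
count-≤-∸1 {n = suc n} P? j ¬pj =
  ℕ.≤-trans (ℕ.≤-reflexive (count-punchIn P? j ¬pj)) (count-≤ (P? ∘ punchIn j))

∑-const : ∀ n c → ∑[ i < n ] c ≡ n * c
∑-const zero    c = refl
∑-const (suc n) c = cong (_+_ c) (∑-const n c)

∑-mono-≤ : (f g : Fin n → ℕ) → (∀ i → f i ≤ g i) → ∑[ i < n ] f i ≤ ∑[ i < n ] g i
∑-mono-≤ {n = zero}  f g f≤g = z≤n
∑-mono-≤ {n = suc n} f g f≤g = ℕ.+-mono-≤ (f≤g zero) (∑-mono-≤ (f ∘ suc) (g ∘ suc) (f≤g ∘ suc))

∑-↑ : ∀ m {n} (f : Fin (m + n) → ℕ) →
      ∑[ q < m + n ] f q ≡ ∑[ i < m ] f (i ↑ˡ n) + ∑[ j < n ] f (m ↑ʳ j)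
∑-↑ zero    f = refl
∑-↑ (suc m) f = trans (cong (_+_ (f zero)) (∑-↑ m (f ∘ suc))) (sym (ℕ.+-assoc (f zero) _ _))

∑-indicator : (x : Fin c) → ∑[ q < c ] (if does (x ≟ q) then 1 else 0) ≡ 1
∑-indicator {suc c} zero    = cong suc (sum-replicate-zero c)
∑-indicator {suc c} (suc x) = ∑-indicator x

∑-count-fibres : (f : Fin t → Fin c) → ∑[ q < c ] count (λ a → f a ≟ q) ≡ t
∑-count-fibres {t} {c} f = begin
  ∑[ q < c ] ∑[ a < t ] (if does (f a ≟ q) then 1 else 0) ≡⟨ ∑-comm (λ q a → if does (f a ≟ q) then 1 else 0) ⟩
  ∑[ a < t ] ∑[ q < c ] (if does (f a ≟ q) then 1 else 0) ≡⟨ sum-cong-≗ (∑-indicator ∘ f) ⟩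
  ∑[ a < t ] 1                                             ≡⟨ ∑-const t 1 ⟩
  t * 1                                                    ≡⟨ ℕ.*-identityʳ t ⟩
  t                                                        ∎
  where open ≡-Reasoning


injective? : (f : Fin t → ℕ) → Dec (Injective _≡_ _≡_ f)
injective? f = map′ (λ inj {a} {b} → inj a b) (λ inj a b → inj)
  (all? λ a → all? λ b → (f a ℕ.≟ f b) →-dec (a ≟ b))

¬injective⇒collision : (f : Fin t → ℕ) → ¬ Injective _≡_ _≡_ f → ∃₂ λ a b → a ≢ b × f a ≡ f b
¬injective⇒collision f ¬inj with any? (λ a → any? λ b → ¬? (a ≟ b) ×-dec (f a ℕ.≟ f b))
... | yes (a , b , a≢b , eq) = a , b , a≢b , eq
... | no ¬collision = contradiction
  (λ {a} {b} eq → decidable-stable (a ≟ b) λ a≢b → ¬collision (a , b , a≢b , eq)) ¬inj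

injective-≤1 : ∀ {X : Set} → u ≤ 1 → (f : Fin u → X) → Injective _≡_ _≡_ f
injective-≤1 (s≤s z≤n) f {zero} {zero} _ = refl

separates⇒injective : ∀ {X : Set} {p} (row : X → ℕ) (s : Fin t → X) (π : Fin t → Fin p) →
                      Injective _≡_ _≡_ π → (∀ a b → π a ≢ π b → row (s a) ≢ row (s b)) →
                      Injective _≡_ _≡_ (row ∘ s)
separates⇒injective row s π π-inj sep {a} {b} eq with a ≟ b
... | yes a≡b = a≡b
... | no a≢b  = contradiction eq (sep a b (a≢b ∘ π-inj))

colliding? : ∀ {N} (A : Array N k) (s : Fin u → Fin k) → Decidable (λ r → ¬ Injective _≡_ _≡_ (A r ∘ s))
colliding? A s r = ¬? (injective? (A r ∘ s))

collidingRows : ∀ {N} → Array N k → (Fin u → Fin k) → ℕ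
collidingRows A s = count (colliding? A s)

-- Fractal perfect hash families

dhhf-injectiveRow : ∀ {N w p} {A : Array N k} → IsDHHF N k w t p A → t ≤ p →
                    (s : Fin t → Fin k) → Injective _≡_ _≡_ s → ∃ λ r → Injective _≡_ _≡_ (A r ∘ s)
dhhf-injectiveRow {A = A} (_ , separated) t≤p s s-inj with separated s s-inj (λ a → inject≤ a t≤p)
... | r , sep = r , separates⇒injective (A r) s _ (Fin.inject≤-injective t≤p t≤p _ _) sep

fractal⇒dhhf : ∀ N {v p} {A : Array N k} → IsFractalDHHF N k v p A → IsDHHF N k v N p A
fractal⇒dhhf zero                F       = F
fractal⇒dhhf (suc zero)          F       = F
fractal⇒dhhf (suc (suc zero))    F       = F
fractal⇒dhhf (suc (suc (suc N))) (D , _) = D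

fractal-injectiveRow : ∀ N {v p} {A : Array N k} → IsFractalDHHF N k v p A → N ≤ p →
                       2 ≤ u → u ≤ N → (s : Fin u → Fin k) → Injective _≡_ _≡_ s →
                       ∃ λ r → Injective _≡_ _≡_ (A r ∘ s)
fractal-injectiveRow N F N≤p 2≤u u≤N s s-inj with ℕ.m≤n⇒m<n∨m≡n u≤N
... | inj₂ refl = dhhf-injectiveRow (fractal⇒dhhf N F) N≤p s s-inj
fractal-injectiveRow (suc (suc (suc N))) (_ , F) N≤p 2≤u u≤N s s-inj | inj₁ (s≤s u≤2+N) =
  let r , injective = fractal-injectiveRow (suc (suc N)) (F zero) (ℕ.⊓-glb (ℕ.<⇒≤ N≤p) ℕ.≤-refl)
                                           2≤u u≤2+N s s-inj
  in suc r , injective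
fractal-injectiveRow (suc (suc zero)) F N≤p (s≤s (s≤s z≤n)) u≤N s s-inj | inj₁ (s≤s (s≤s ()))
fractal-injectiveRow (suc zero)       F N≤p (s≤s (s≤s z≤n)) u≤N s s-inj | inj₁ (s≤s ())

-- Deleting a row that is injective on the set leaves a fractal family with the same
-- colliding rows, so induction on N applies.
collidingRows-fractal : ∀ N {v p} {A : Array N k} → IsFractalDHHF N k v p A → N ≤ p →
                        (s : Fin u → Fin k) → Injective _≡_ _≡_ s → collidingRows A s ≤ u ∸ 1
collidingRows-fractal {u = u} N {A = A} F N≤p s s-inj with u ℕ.≤? 1 | ℕ.<-cmp u N
... | yes u≤1 | _ = ℕ.≤-trans (ℕ.≤-reflexive (count-≡0 (colliding? A s) λ r ¬inj →
                                                ¬inj (injective-≤1 u≤1 (A r ∘ s)))) z≤n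
... | no _ | tri> _ _ N<u = ℕ.≤-trans (count-≤ (colliding? A s)) (ℕ.∸-monoˡ-≤ 1 N<u)
... | no u≰1 | tri≈ _ refl _ =
  let r , injective = fractal-injectiveRow N F N≤p (ℕ.≰⇒> u≰1) ℕ.≤-refl s s-inj
  in count-≤-∸1 (colliding? A s) r λ ¬inj → ¬inj injective
collidingRows-fractal (suc (suc (suc N))) {A = A} F@(_ , F′) N≤p s s-inj | no u≰1 | tri< u<N _ _ =
  let r , injective = fractal-injectiveRow _ F N≤p (ℕ.≰⇒> u≰1) (ℕ.<⇒≤ u<N) s s-inj
  in ℕ.≤-trans (ℕ.≤-reflexive (count-punchIn (colliding? A s) r λ ¬inj → ¬inj injective))
               (collidingRows-fractal (suc (suc N)) (F′ r) (ℕ.⊓-glb (ℕ.<⇒≤ N≤p) ℕ.≤-refl) s s-inj)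
collidingRows-fractal (suc zero)       F N≤p s s-inj | no u≰1 | tri< (s≤s z≤n) _ _ = contradiction z≤n u≰1
collidingRows-fractal (suc (suc zero)) F N≤p s s-inj | no u≰1 | tri< (s≤s u≤1) _ _ = contradiction u≤1 u≰1

-- The cyclic design on seven rows and seven groups

allFin : (Fin n → Bool) → Bool
allFin {zero}  P = true
allFin {suc n} P = P zero ∧ allFin (P ∘ suc)

allFin-sound : (P : Fin n → Bool) → allFin P ≡ true → ∀ i → P i ≡ true
allFin-sound {suc n} P all i with P zero in P₀
allFin-sound {suc n} P all zero    | true = P₀
allFin-sound {suc n} P all (suc i) | true = allFin-sound (P ∘ suc) all i

allVec : ∀ n → (Vec (Fin m) n → Bool) → Bool
allVec zero    P = P []
allVec (suc n) P = allFin λ x → allVec n (P ∘ (x ∷_))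

allVec-sound : ∀ n (P : Vec (Fin m) n → Bool) → allVec n P ≡ true → ∀ v → P v ≡ true
allVec-sound zero    P all []      = all
allVec-sound (suc n) P all (x ∷ v) = allVec-sound n (P ∘ (x ∷_)) (allFin-sound _ all x) v

-- An identity alphabet (three of them) or a row of B (four of them).
Slot : Set
Slot = Fin 3 ⊎ Fin 4

_⊖_ : Fin 7 → Fin 7 → Fin 7
g ⊖ ρ = (7 + toℕ g ∸ toℕ ρ) mod 7

-- The identity slots sit at the offsets {0, 1, 3}, a planar difference set modulo 7.
slot : Fin 7 → Slot
slot zero                                     = inj₁ zero
slot (suc zero)                               = inj₁ (suc zero)
slot (suc (suc zero))                         = inj₂ zero
slot (suc (suc (suc zero)))                   = inj₁ (suc (suc zero))
slot (suc (suc (suc (suc zero))))             = inj₂ (suc zero)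
slot (suc (suc (suc (suc (suc zero)))))       = inj₂ (suc (suc zero))
slot (suc (suc (suc (suc (suc (suc zero)))))) = inj₂ (suc (suc (suc zero)))

role : Fin 7 → Fin 7 → Slot
role ρ g = slot (g ⊖ ρ)

offset : Fin 4 → Fin 7
offset zero                   = suc (suc zero)
offset (suc zero)             = suc (suc (suc (suc zero)))
offset (suc (suc zero))       = suc (suc (suc (suc (suc zero))))
offset (suc (suc (suc zero))) = suc (suc (suc (suc (suc (suc zero)))))

rowOf : Fin 7 → Fin 4 → Fin 7
rowOf g l = g ⊖ offset l

role-injective : ∀ ρ {g g′} → role ρ g ≡ role ρ g′ → g ≡ g′
role-injective ρ {g} {g′} = toWitness {a? = all? λ ρ → all? λ g → all? λ g′ →
  Sum.≡-dec _≟_ _≟_ (role ρ g) (role ρ g′) →-dec (g ≟ g′)} tt ρ g g′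

role-rowOf : ∀ g l → role (rowOf g l) g ≡ inj₂ l
role-rowOf = toWitness {a? = all? λ g → all? λ l → Sum.≡-dec _≟_ _≟_ (role (rowOf g l) g) (inj₂ l)} tt

-- The fewest columns a group can meet the set in when f of its B-rows collide on them.
columnsNeeded : ℕ → ℕ
columnsNeeded zero    = zero
columnsNeeded (suc f) = suc (suc f)

columnsNeeded-≤ : ∀ {f} → f ≤ u ∸ 1 → columnsNeeded f ≤ u
columnsNeeded-≤ {f = zero}            _   = z≤n
columnsNeeded-≤ {suc u} {f = suc f} f<u = s≤s f<u

-- Row ρ picks the B-row d ρ colliding in group ρ + offset (d ρ).
assignmentCost : (Fin 7 → Fin 4) → ℕ
assignmentCost d = ∑[ g < 7 ] columnsNeeded (count λ l → d (rowOf g l) ≟ l)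

costly : Vec (Fin 4) 7 → Bool
costly d = 10 ≤ᵇ assignmentCost (lookup d)

-- The seven picks fill seven distinct (group, B-row) slots, and they meet at least three
-- groups, since two translates of {1, 2, 3, 5} never cover ℤ/7: so the cost is ≥ 7 + 3.
-- We check all 4⁷ assignments.
allAssignmentsCostly : allVec 7 costly ≡ true
allAssignmentsCostly = refl

10≤assignmentCost : ∀ (d : Vec (Fin 4) 7) → 10 ≤ assignmentCost (lookup d)
10≤assignmentCost d = ℕ.≤ᵇ⇒≤ 10 (assignmentCost (lookup d))
  (subst T (sym (allVec-sound 7 costly allAssignmentsCostly d)) tt)

-- Encoding symbols as natural numbers

Σ-encode : (w : Fin n → ℕ) → Σ (Fin n) (Fin ∘ w) → Fin (sum w)
Σ-encode w (zero  , x) = x ↑ˡ sum (w ∘ suc)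
Σ-encode w (suc l , x) = w zero ↑ʳ Σ-encode (w ∘ suc) (l , x)

Σ-encode-injective : (w : Fin n → ℕ) → Injective _≡_ _≡_ (Σ-encode w)
Σ-encode-injective w {zero , x} {zero , y} eq = cong (zero ,_) (Fin.↑ˡ-injective _ x y eq)
Σ-encode-injective w {zero , x} {suc l , y} eq
  with trans (sym (Fin.splitAt-↑ˡ _ x _)) (trans (cong (splitAt _) eq) (Fin.splitAt-↑ʳ _ _ _))
... | ()
Σ-encode-injective w {suc l , x} {zero , y} eq
  with trans (sym (Fin.splitAt-↑ʳ _ _ _)) (trans (cong (splitAt _) eq) (Fin.splitAt-↑ˡ _ y _))
... | ()
Σ-encode-injective w {suc l , x} {suc l′ , y} eq
  with Σ-encode-injective (w ∘ suc) {l , x} {l′ , y} (Fin.↑ʳ-injective (w zero) _ _ eq)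
... | refl = refl

Σ↣ : (w : Fin n → ℕ) → Σ (Fin n) (Fin ∘ w) ↣ Fin (sum w)
Σ↣ w = mk↣ (Σ-encode-injective w)

⊎↣+ : (Fin m ⊎ Fin n) ↣ Fin (m + n)
⊎↣+ = ↔⇒↣ (↔-sym +↔⊎)

×↣* : (Fin m × Fin n) ↣ Fin (m * n)
×↣* = ↔⇒↣ (↔-sym *↔×)

toℕ-atMostDistinct : ∀ {W} (f : Fin k → Fin W) → Fin W → AtMostDistinct (toℕ ∘ f) W
toℕ-atMostDistinct {W = suc W} f _ =
  (_mod suc W) , λ c c′ eq → trans (sym (toℕ-mod (f c))) (trans (cong toℕ eq) (toℕ-mod (f c′)))
  where
  toℕ-mod : (i : Fin (suc W)) → toℕ (toℕ i mod suc W) ≡ toℕ i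
  toℕ-mod i = trans (Fin.toℕ-fromℕ< _) (m<n⇒m%n≡m (Fin.toℕ<n i))

collapse : Fin m → Fin m × Fin k → Fin (m ∸ 1) × Fin k ⊎ ⊤
collapse {suc m} j (j′ , c) with j ≟ j′
... | yes _    = inj₂ tt
... | no j≢j′ = inj₁ (punchOut j≢j′ , c)

collapse-collision : ∀ (j : Fin m) {x y : Fin m × Fin k} → collapse j x ≡ collapse j y →
                     x ≡ y ⊎ (proj₁ x ≡ j × proj₁ y ≡ j)
collapse-collision {suc m} j {j₁ , c₁} {j₂ , c₂} eq with j ≟ j₁ | j ≟ j₂
... | yes j≡j₁ | yes j≡j₂ = inj₂ (sym j≡j₁ , sym j≡j₂)
... | no j≢j₁  | no j≢j₂  with inj₁-injective eq
...   | eq′ with Fin.punchOut-injective j≢j₁ j≢j₂ (cong proj₁ eq′) | cong proj₂ eq′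
...     | refl | refl = inj₁ refl
collapse-collision {suc m} j eq | yes _ | no _ with eq
... | ()
collapse-collision {suc m} j eq | no _ | yes _ with eq
... | ()

↑-elim : ∀ {a b} (P : Fin (a + b) → Set) → (∀ i → P (i ↑ˡ b)) → (∀ j → P (a ↑ʳ j)) → ∀ i → P i
↑-elim {a} P left right i with splitAt a i in eq
... | inj₁ i′ = subst P (Fin.splitAt⁻¹-↑ˡ eq) (left i′)
... | inj₂ j  = subst P (Fin.splitAt⁻¹-↑ʳ eq) (right j)

exp7-↑ˡ : ∀ {x y} (ρ : Fin 7) → exp7 x y (ρ ↑ˡ m) ≡ x
exp7-↑ˡ {m} {x} {y} ρ = cong (λ b → if b then x else y)
  (dec-true (toℕ (ρ ↑ˡ m) ℕ.<? 7) (subst (_< 7) (sym (Fin.toℕ-↑ˡ ρ m)) (Fin.toℕ<n ρ)))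

-- The left-hand side computes to 2 + (m + (7 + (m + 0))).
2*[7+m]∸5≡9+m*2 : ∀ m → 2 * (7 + m) ∸ 5 ≡ 9 + m * 2
2*[7+m]∸5≡9+m*2 m = normalised m
  where
  normalised : ∀ m → 2 + (m + (7 + (m + 0))) ≡ 9 + m * 2
  normalised = ℕ-Solver.solve-∀

-- The construction

module Construction {κ : ℕ} {w : Fin 4 → ℕ} (B : Array 4 κ) (B-fractal : IsFractalPHHF 4 κ w B)
                    (m k : ℕ) where

  B-hhf : IsHHF 4 κ w B
  B-hhf = proj₁ (fractal⇒dhhf 4 B-fractal)

  Column : Set
  Column = Fin 7 × Fin κ ⊎ Fin m × Fin k

  columns : Fin (7 * κ + m * k) ↔ Column
  columns = (*↔× ⊎-↔ *↔×) ↔-∘ +↔⊎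

  decode : Fin (7 * κ + m * k) → Column
  decode = Inverse.to columns

  decode-injective : Injective _≡_ _≡_ decode
  decode-injective = Injection.injective (↔⇒↣ columns)

  part : Column → Fin (7 + m)
  part = join 7 m ∘ Sum.map proj₁ proj₁

  part-↑ˡ : ∀ {g} x → part x ≡ g ↑ˡ m → ∃ λ c → x ≡ inj₁ (g , c)
  part-↑ˡ (inj₁ (g , c)) eq = c , cong (λ g → inj₁ (g , c)) (Fin.↑ˡ-injective m g _ eq)
  part-↑ˡ {g} (inj₂ (j , c)) eq
    with trans (sym (Fin.splitAt-↑ʳ 7 m j)) (trans (cong (splitAt 7) eq) (Fin.splitAt-↑ˡ 7 g m))
  ... | ()

  bSymbol : (l : Fin 4) → Fin κ → Fin (w l)
  bSymbol l = proj₁ (B-hhf l) ∘ B l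

  SlotSymbol : Set
  SlotSymbol = Fin 3 × Fin κ ⊎ Σ (Fin 4) (Fin ∘ w)

  slotSymbol : Slot → Fin κ → SlotSymbol
  slotSymbol (inj₁ e) c = inj₁ (e , c)
  slotSymbol (inj₂ l) c = inj₂ (l , bSymbol l c)

  slotSymbol-collision : ∀ σ σ′ {c c′} → slotSymbol σ c ≡ slotSymbol σ′ c′ →
                         σ ≡ σ′ × (c ≡ c′ ⊎ ∃ λ l → σ ≡ inj₂ l × B l c ≡ B l c′)
  slotSymbol-collision (inj₁ e) (inj₁ e) refl = refl , inj₁ refl
  slotSymbol-collision (inj₂ l) (inj₂ l′) {c} {c′} eq with Σ-≡,≡←≡ (inj₂-injective eq)
  ... | refl , eq′ = refl , inj₂ (l , refl , proj₂ (B-hhf l) c c′ eq′)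

  GSymbol : Set
  GSymbol = SlotSymbol ⊎ Fin m × Fin k

  gSymbol : Fin 7 → Column → GSymbol
  gSymbol ρ (inj₁ (g , c)) = inj₁ (slotSymbol (role ρ g) c)
  gSymbol ρ (inj₂ x)       = inj₂ x

  SharedBSymbol : Fin 7 → Column → Column → Set
  SharedBSymbol ρ x y = ∃₂ λ g l → role ρ g ≡ inj₂ l ×
    ∃₂ λ c c′ → x ≡ inj₁ (g , c) × y ≡ inj₁ (g , c′) × B l c ≡ B l c′

  gSymbol-collision : ∀ ρ {x y} → gSymbol ρ x ≡ gSymbol ρ y → x ≡ y ⊎ SharedBSymbol ρ x y
  gSymbol-collision ρ {inj₁ (g , c)} {inj₁ (g′ , c′)} eq
    with slotSymbol-collision (role ρ g) (role ρ g′) (inj₁-injective eq)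
  ... | σ≡σ′ , same with role-injective ρ σ≡σ′
  ...   | refl with same
  ...     | inj₁ refl                 = inj₁ refl
  ...     | inj₂ (l , σ≡l , Bc≡Bc′) = inj₂ (g , l , σ≡l , c , c′ , refl , refl , Bc≡Bc′)
  gSymbol-collision ρ {inj₂ _} {inj₂ _} refl = inj₁ refl

  HSymbol : Set
  HSymbol = Fin 7 × Fin κ ⊎ (Fin (m ∸ 1) × Fin k ⊎ ⊤)

  hSymbol : Fin m → Column → HSymbol
  hSymbol j (inj₁ x) = inj₁ x
  hSymbol j (inj₂ x) = inj₂ (collapse j x)

  hSymbol-collision : ∀ j {x y} → hSymbol j x ≡ hSymbol j y →
                      x ≡ y ⊎ (part x ≡ 7 ↑ʳ j × part y ≡ 7 ↑ʳ j)
  hSymbol-collision j {inj₁ _} {inj₁ _} refl = inj₁ refl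
  hSymbol-collision j {inj₂ x} {inj₂ y} eq with collapse-collision j (inj₂-injective eq)
  ... | inj₁ refl          = inj₁ refl
  ... | inj₂ (refl , refl) = inj₂ (refl , refl)

  gEncoding : GSymbol ↣ Fin (3 * κ + sum w + m * k)
  gEncoding = ⊎↣+ ↣-∘ ((⊎↣+ ↣-∘ (×↣* ⊎-↣ Σ↣ w)) ⊎-↣ ×↣*)

  hEncoding : HSymbol ↣ Fin (7 * κ + ((m ∸ 1) * k + 1))
  hEncoding = ⊎↣+ ↣-∘ (×↣* ⊎-↣ (⊎↣+ ↣-∘ (×↣* ⊎-↣ ↔⇒↣ (↔-sym 1↔⊤))))

  rowValue : Fin 7 ⊎ Fin m → Column → ℕ
  rowValue (inj₁ ρ) = toℕ ∘ Injection.to gEncoding ∘ gSymbol ρ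
  rowValue (inj₂ j) = toℕ ∘ Injection.to hEncoding ∘ hSymbol j

  array : Array (7 + m) (7 * κ + m * k)
  array i = rowValue (splitAt 7 i) ∘ decode

  module Restriction (S : Fin t → Column) (S-injective : Injective _≡_ _≡_ S) where

    inPart? : (q : Fin (7 + m)) → Decidable (λ a → part (S a) ≡ q)
    inPart? q a = part (S a) ≟ q

    groupSize : Fin 7 → ℕ
    groupSize g = count (inPart? (g ↑ˡ m))

    blockSize : Fin m → ℕ
    blockSize j = count (inPart? (7 ↑ʳ j))

    sizes-sum : ∑[ g < 7 ] groupSize g + ∑[ j < m ] blockSize j ≡ t
    sizes-sum = trans (sym (∑-↑ 7 (count ∘ inPart?))) (∑-count-fibres (part ∘ S))

    groupMember : (g : Fin 7) → Fin (groupSize g) → Fin t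
    groupMember g = select (inPart? (g ↑ˡ m))

    groupColumn : (g : Fin 7) → Fin (groupSize g) → Fin κ
    groupColumn g i = proj₁ (part-↑ˡ (S (groupMember g i)) (select-∈ (inPart? (g ↑ˡ m)) i))

    groupMember-column : ∀ g i → S (groupMember g i) ≡ inj₁ (g , groupColumn g i)
    groupMember-column g i = proj₂ (part-↑ˡ (S (groupMember g i)) (select-∈ (inPart? (g ↑ˡ m)) i))

    groupColumn-injective : ∀ g → Injective _≡_ _≡_ (groupColumn g)
    groupColumn-injective g {i} {i′} eq = select-injective (inPart? (g ↑ˡ m)) (S-injective (begin
      S (groupMember g i)         ≡⟨ groupMember-column g i ⟩
      inj₁ (g , groupColumn g i)  ≡⟨ cong (λ c → inj₁ (g , c)) eq ⟩
      inj₁ (g , groupColumn g i′) ≡⟨ groupMember-column g i′ ⟨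
      S (groupMember g i′)        ∎))
      where open ≡-Reasoning

    groupIndex : ∀ {a g c} → S a ≡ inj₁ (g , c) → ∃ λ i → groupMember g i ≡ a × groupColumn g i ≡ c
    groupIndex {a} {g} Sa≡ with select-surjective (inPart? (g ↑ˡ m)) (cong part Sa≡)
    ... | i , refl = i , refl , ,-injectiveʳ (inj₁-injective (trans (sym (groupMember-column g i)) Sa≡))

    gRow-collides⇒bRow-collides : ∀ ρ → ¬ Injective _≡_ _≡_ (rowValue (inj₁ ρ) ∘ S) →
                                  ∃₂ λ g l → role ρ g ≡ inj₂ l × ¬ Injective _≡_ _≡_ (B l ∘ groupColumn g)
    gRow-collides⇒bRow-collides ρ ¬inj with ¬injective⇒collision _ ¬inj
    ... | a , b , a≢b , eq
      with gSymbol-collision ρ (Injection.injective gEncoding (Fin.toℕ-injective eq))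
    ...   | inj₁ Sa≡Sb = contradiction (S-injective Sa≡Sb) a≢b
    ...   | inj₂ (g , l , σ≡l , c , c′ , Sa≡ , Sb≡ , Bc≡Bc′) with groupIndex Sa≡ | groupIndex Sb≡
    ...     | i , refl , refl | i′ , refl , refl =
      g , l , σ≡l , λ injective → a≢b (cong (groupMember g) (injective Bc≡Bc′))

    hRow-collides⇒2≤blockSize : ∀ j → ¬ Injective _≡_ _≡_ (rowValue (inj₂ j) ∘ S) → 2 ≤ blockSize j
    hRow-collides⇒2≤blockSize j ¬inj with ¬injective⇒collision _ ¬inj
    ... | a , b , a≢b , eq
      with hSymbol-collision j (Injection.injective hEncoding (Fin.toℕ-injective eq))
    ...   | inj₁ Sa≡Sb         = contradiction (S-injective Sa≡Sb) a≢b
    ...   | inj₂ (a∈j , b∈j) = two≤count (inPart? (7 ↑ʳ j)) a≢b a∈j b∈j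

    allRowsCollide⇒10+m*2≤t : (∀ R → ¬ Injective _≡_ _≡_ (rowValue R ∘ S)) → 10 + m * 2 ≤ t
    allRowsCollide⇒10+m*2≤t collide = begin
      10 + m * 2                                      ≤⟨ ℕ.+-mono-≤ groupsBound blocksBound ⟩
      ∑[ g < 7 ] groupSize g + ∑[ j < m ] blockSize j ≡⟨ sizes-sum ⟩
      t                                               ∎
      where
      open ℕ.≤-Reasoning

      bCollision : ∀ ρ → ∃₂ λ g l → role ρ g ≡ inj₂ l × ¬ Injective _≡_ _≡_ (B l ∘ groupColumn g)
      bCollision ρ = gRow-collides⇒bRow-collides ρ (collide (inj₁ ρ))

      collidingBRow : Vec (Fin 4) 7
      collidingBRow = tabulate λ ρ → proj₁ (proj₂ (bCollision ρ))

      bRow-collides : ∀ g l → lookup collidingBRow (rowOf g l) ≡ l →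
                      ¬ Injective _≡_ _≡_ (B l ∘ groupColumn g)
      bRow-collides g l eq = subst₂ (λ g′ l′ → ¬ Injective _≡_ _≡_ (B l′ ∘ groupColumn g′)) g′≡g l′≡l
                                    (proj₂ (proj₂ (proj₂ (bCollision ρ))))
        where
        ρ = rowOf g l
        l′≡l : proj₁ (proj₂ (bCollision ρ)) ≡ l
        l′≡l = trans (sym (lookup∘tabulate (λ ρ → proj₁ (proj₂ (bCollision ρ))) ρ)) eq
        g′≡g : proj₁ (bCollision ρ) ≡ g
        g′≡g = role-injective ρ (trans (proj₁ (proj₂ (proj₂ (bCollision ρ))))
                                       (trans (cong inj₂ l′≡l) (sym (role-rowOf g l))))

      groupBound : ∀ g → columnsNeeded (count λ l → lookup collidingBRow (rowOf g l) ≟ l) ≤ groupSize g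
      groupBound g = columnsNeeded-≤ (ℕ.≤-trans
        (count-mono (λ l → lookup collidingBRow (rowOf g l) ≟ l) (colliding? B (groupColumn g))
                    (bRow-collides g _))
        (collidingRows-fractal 4 B-fractal ℕ.≤-refl (groupColumn g) (groupColumn-injective g)))

      groupsBound : 10 ≤ ∑[ g < 7 ] groupSize g
      groupsBound = ℕ.≤-trans (10≤assignmentCost collidingBRow)
        (∑-mono-≤ (λ g → columnsNeeded (count λ l → lookup collidingBRow (rowOf g l) ≟ l)) groupSize groupBound)

      blocksBound : m * 2 ≤ ∑[ j < m ] blockSize j
      blocksBound = ℕ.≤-trans (ℕ.≤-reflexive (sym (∑-const m 2)))
        (∑-mono-≤ _ _ λ j → hRow-collides⇒2≤blockSize j (collide (inj₂ j)))

  array-isHHF : (W : Fin (7 + m) → ℕ) → (∀ ρ → 3 * κ + sum w + m * k ≡ W (ρ ↑ˡ m)) →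
                (∀ j → 7 * κ + ((m ∸ 1) * k + 1) ≡ W (7 ↑ʳ j)) → IsHHF (7 + m) (7 * κ + m * k) W array
  array-isHHF W W₁≡ W₂≡ = ↑-elim (λ i → AtMostDistinct (array i) (W i)) gRow hRow
    where
    rowOfArray : ∀ i {R} → splitAt 7 i ≡ R → array i ≡ rowValue R ∘ decode
    rowOfArray _ = cong (λ R → rowValue R ∘ decode)

    -- B-hhf supplies a symbol even when κ = 0.
    gRow : ∀ ρ → AtMostDistinct (array (ρ ↑ˡ m)) (W (ρ ↑ˡ m))
    gRow ρ = subst₂ AtMostDistinct (sym (rowOfArray (ρ ↑ˡ m) (Fin.splitAt-↑ˡ 7 ρ m))) (W₁≡ ρ)
      (toℕ-atMostDistinct (Injection.to gEncoding ∘ gSymbol ρ ∘ decode)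
                          (Injection.to gEncoding (inj₁ (inj₂ (zero , proj₁ (B-hhf zero) 0)))))

    hRow : ∀ j → AtMostDistinct (array (7 ↑ʳ j)) (W (7 ↑ʳ j))
    hRow j = subst₂ AtMostDistinct (sym (rowOfArray (7 ↑ʳ j) (Fin.splitAt-↑ʳ 7 m j))) (W₂≡ j)
      (toℕ-atMostDistinct (Injection.to hEncoding ∘ hSymbol j ∘ decode)
                          (Injection.to hEncoding (inj₂ (inj₂ tt))))

  array-separates : ∀ (s : Fin (2 * (7 + m) ∸ 5) → Fin (7 * κ + m * k)) → Injective _≡_ _≡_ s →
                    (π : Fin (2 * (7 + m) ∸ 5) → Fin (2 * (7 + m) ∸ 5)) → ∃ λ r → Separates array r s π
  array-separates s s-inj π = decide (any? (λ r → injective? (array r ∘ s)))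
    where
    S-injective : Injective _≡_ _≡_ (decode ∘ s)
    S-injective = s-inj ∘ decode-injective

    decide : Dec (∃ λ r → Injective _≡_ _≡_ (array r ∘ s)) → ∃ λ r → Separates array r s π
    decide (yes (r , injective)) = r , λ a b πa≢πb → πa≢πb ∘ cong π ∘ injective
    decide (no ¬injective) =
      contradiction (Restriction.allRowsCollide⇒10+m*2≤t (decode ∘ s) S-injective collide) too-many
      where
      collide : ∀ R → ¬ Injective _≡_ _≡_ (rowValue R ∘ decode ∘ s)
      collide R injective = ¬injective (join 7 m R ,
        subst (λ R′ → Injective _≡_ _≡_ (rowValue R′ ∘ decode ∘ s)) (sym (Fin.splitAt-join 7 m R)) injective)

      too-many : ¬ (10 + m * 2 ≤ 2 * (7 + m) ∸ 5)
      too-many = ℕ.<⇒≱ (ℕ.≤-reflexive (cong suc (2*[7+m]∸5≡9+m*2 m)))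

  array-isPHHF : (W : Fin (7 + m) → ℕ) → (∀ ρ → 3 * κ + sum w + m * k ≡ W (ρ ↑ˡ m)) →
                 (∀ j → 7 * κ + ((m ∸ 1) * k + 1) ≡ W (7 ↑ʳ j)) →
                 IsPHHF (7 + m) (7 * κ + m * k) W (2 * (7 + m) ∸ 5) array
  array-isPHHF W W₁≡ W₂≡ = array-isHHF W W₁≡ W₂≡ , array-separates

symsI₂-8+ : ∀ m κ k → symsI₂ (8 + m) κ k ≡ 7 * κ + (m * k + 1)
symsI₂-8+ m κ k = trans (cong (λ x → ∣ + (7 * κ) ℤ.+ x ℤ.+ + 1 ∣) (sym (ℤ.pos-* m k)))
                        (ℕ.+-assoc (7 * κ) (m * k) 1)

k₀ : ℕ → ℕ → ℕ
k₀ κ W = 4 * κ ∸ W + 1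

-- colsII and symsII at 7 + m unfold definitionally to the left-hand sides of the identities.
module _ (κ W : ℕ) (W≤4κ : W ≤ 4 * κ) where
  open ℤ-Solver using (solve-∀)

  k₀-ℤ : + k₀ κ W ≡ + 4 ℤ.* + κ ℤ.+ + 1 ℤ.- + W
  k₀-ℤ = begin
    + (4 * κ ∸ W) ℤ.+ + 1        ≡⟨ cong (λ x → x ℤ.+ + 1) (sym (trans (ℤ.m-n≡m⊖n (4 * κ) W) (ℤ.⊖-≥ W≤4κ))) ⟩
    + (4 * κ) ℤ.- + W ℤ.+ + 1    ≡⟨ cong (λ x → x ℤ.- + W ℤ.+ + 1) (ℤ.pos-* 4 κ) ⟩
    + 4 ℤ.* + κ ℤ.- + W ℤ.+ + 1  ≡⟨ swap (+ 4 ℤ.* + κ) (+ W) ⟩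
    + 4 ℤ.* + κ ℤ.+ + 1 ℤ.- + W  ∎
    where
    open ≡-Reasoning
    swap : ∀ a w → a ℤ.- w ℤ.+ + 1 ≡ a ℤ.+ + 1 ℤ.- w
    swap = solve-∀

  collect : ∀ a m → + a ℤ.* + κ ℤ.+ + m ℤ.* (+ 4 ℤ.* + κ ℤ.+ + 1 ℤ.- + W) ≡ + (a * κ + m * k₀ κ W)
  collect a m = cong₂ ℤ._+_ (sym (ℤ.pos-* a κ))
                            (trans (cong (λ x → + m ℤ.* x) (sym k₀-ℤ)) (sym (ℤ.pos-* m (k₀ κ W))))

  colsII-7+ : ∀ m → colsII (7 + m) κ W ≡ 7 * κ + m * k₀ κ W
  colsII-7+ m = cong ∣_∣ (trans (identity (+ m) (+ κ) (+ W)) (collect 7 m))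
    where
    identity : ∀ M K W → (+ 4 ℤ.* (+ 7 ℤ.+ M) ℤ.- + 21) ℤ.* K ℤ.- (+ 7 ℤ.+ M ℤ.- + 7) ℤ.* (W ℤ.- + 1)
                       ≡ + 7 ℤ.* K ℤ.+ M ℤ.* (+ 4 ℤ.* K ℤ.+ + 1 ℤ.- W)
    identity = solve-∀

  symsII-7+ : ∀ m → symsII (7 + m) κ W ≡ 3 * κ + m * k₀ κ W + W
  symsII-7+ m = cong ∣_∣ (trans (identity (+ m) (+ κ) (+ W)) (cong (λ x → x ℤ.+ + W) (collect 3 m)))
    where
    identity : ∀ M K W → (+ 4 ℤ.* (+ 7 ℤ.+ M) ℤ.- + 25) ℤ.* K ℤ.- (+ 7 ℤ.+ M ℤ.- + 8) ℤ.* (W ℤ.- + 1) ℤ.+ + 1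
                       ≡ + 3 ℤ.* K ℤ.+ M ℤ.* (+ 4 ℤ.* K ℤ.+ + 1 ℤ.- W) ℤ.+ W
    identity = solve-∀

  symsII-8+ : ∀ m → symsII (8 + m) κ W ≡ 7 * κ + (m * k₀ κ W + 1)
  symsII-8+ m = trans (cong ∣_∣ (trans (identity (+ m) (+ κ) (+ W)) (cong (λ x → x ℤ.+ + 1) (collect 7 m))))
                      (ℕ.+-assoc (7 * κ) (m * k₀ κ W) 1)
    where
    identity : ∀ M K W → (+ 4 ℤ.* (+ 8 ℤ.+ M) ℤ.- + 25) ℤ.* K ℤ.- (+ 8 ℤ.+ M ℤ.- + 8) ℤ.* (W ℤ.- + 1) ℤ.+ + 1
                       ≡ + 7 ℤ.* K ℤ.+ M ℤ.* (+ 4 ℤ.* K ℤ.+ + 1 ℤ.- W) ℤ.+ + 1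
    identity = solve-∀

regroup-sum₄ : ∀ a b w₁ w₂ w₃ w₄ → a + (w₁ + (w₂ + (w₃ + (w₄ + 0)))) + b ≡ a + b + w₁ + w₂ + w₃ + w₄
regroup-sum₄ = ℕ-Solver.solve-∀

regroup-sum₄′ : ∀ a b w₁ w₂ w₃ w₄ → a + (w₁ + (w₂ + (w₃ + (w₄ + 0)))) + b ≡ a + b + (w₁ + w₂ + w₃ + w₄)
regroup-sum₄′ = ℕ-Solver.solve-∀

lemma23 : (κ w₁ w₂ w₃ w₄ n : ℕ) →
          (∃ λ (B : Array 4 κ) → IsFractalPHHF 4 κ (vec4 w₁ w₂ w₃ w₄) B) →
          7 ≤ n →
          ((k : ℕ) → 1 ≤ k →
            ∃ λ (A : Array n (7 * κ + (n ∸ 7) * k)) →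
              IsPHHF n (7 * κ + (n ∸ 7) * k)
                (exp7 (3 * κ + (n ∸ 7) * k + w₁ + w₂ + w₃ + w₄) (symsI₂ n κ k))
                (2 * n ∸ 5) A)
          ×
          (w₁ + w₂ + w₃ + w₄ ≤ 4 * κ →
            ∃ λ (A : Array n (colsII n κ (w₁ + w₂ + w₃ + w₄))) →
              IsPHF n (colsII n κ (w₁ + w₂ + w₃ + w₄))
                (symsII n κ (w₁ + w₂ + w₃ + w₄)) (2 * n ∸ 5) A)
lemma23 κ w₁ w₂ w₃ w₄ n (B , B-fractal) 7≤n with ℕ.m≤n⇒∃[o]m+o≡n 7≤n
... | m , refl = partI , partII
  where
  W = w₁ + w₂ + w₃ + w₄

  -- The construction does not need k ≥ 1.
  partI : (k : ℕ) → 1 ≤ k → _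
  partI k _ = array , array-isPHHF _ (λ ρ → trans (regroup-sum₄ (3 * κ) (m * k) w₁ w₂ w₃ w₄) (sym (exp7-↑ˡ ρ)))
                                     (hWidth m)
    where
    open Construction B B-fractal m k
    hWidth : ∀ m → Fin m → 7 * κ + ((m ∸ 1) * k + 1) ≡ symsI₂ (7 + m) κ k
    hWidth (suc m) _ = sym (symsI₂-8+ m κ k)

  partII : W ≤ 4 * κ → _
  partII W≤4κ = subst (λ K → ∃ λ (A : Array (7 + m) K) → IsPHF (7 + m) K (symsII (7 + m) κ W) (2 * (7 + m) ∸ 5) A)
    (sym (colsII-7+ κ W W≤4κ m))
    (array , array-isPHHF _ (λ _ → trans (regroup-sum₄′ (3 * κ) (m * k₀ κ W) w₁ w₂ w₃ w₄) (sym (symsII-7+ κ W W≤4κ m)))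
                            (hWidth m))
    where
    open Construction B B-fractal m (k₀ κ W)
    hWidth : ∀ m → Fin m → 7 * κ + ((m ∸ 1) * k₀ κ W + 1) ≡ symsII (7 + m) κ W
    hWidth (suc m) _ = sym (symsII-8+ κ W W≤4κ m)
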